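{- Let $n,k$ be integers with $k\ge1$, $n>2k$, and let $c^*$ be a minimum vertex cover of the generalized Petersen graph $P(n,k)$. If $v_i\in c^*$ and both of its neighbours in $V$, namely $v_{i-k}$ and $v_{i+k}$, are in $c^*$, then there exists a minimum vertex cover $c$ of $P(n,k)$ with $c\cap V=(c^*\cap V)\setminus\{v_i\}$.
   Context: $P(n,k)$ has vertex set $U\cup V$, $U=\{u_1,\dots,u_n\}$, $V=\{v_1,\dots,v_n\}$, edges $u_iu_{i+1}$, $u_iv_i$, $v_iv_{i+k}$ (subscripts modulo $n$). -}

module Defs where

open import Data.Nat using (ℕ; _+_; _≤_; NonZero)
open import Data.Nat.DivMod using (_%_)
open import Data.Fin using (Fin; toℕ)
open import Data.Bool using (Bool; true; false; T; _∨_)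
open import Data.List using (List; map; allFin; _++_; length; filter)
open import Data.Product using (_×_)
open import Relation.Binary.PropositionalEquality using (_≡_)

data Vertex (n : ℕ) : Set where
  u : Fin n → Vertex n
  v : Fin n → Vertex n

vertices : (n : ℕ) → List (Vertex n)
vertices n = map u (allFin n) ++ map v (allFin n)

data Edge (n k : ℕ) .{{_ : NonZero n}} : Vertex n → Vertex n → Set where
  outer : (i j : Fin n) → toℕ j ≡ (toℕ i + 1) % n → Edge n k (u i) (u j)
  spoke : (i : Fin n) → Edge n k (u i) (v i)
  inner : (i j : Fin n) → toℕ j ≡ (toℕ i + k) % n → Edge n k (v i) (v j)

VSet : ℕ → Set
VSet n = Vertex n → Bool

_∈_ : {n : ℕ} → Vertex n → VSet n → Set
x ∈ c = T (c x)

size : {n : ℕ} → VSet n → ℕ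
size {n} c = length (filter (λ x → Data.Bool._≟_ (c x) true) (vertices n))
  where import Data.Bool

IsVertexCover : (n k : ℕ) .{{_ : NonZero n}} → VSet n → Set
IsVertexCover n k c = ∀ x y → Edge n k x y → (x ∈ c) Data.Sum.⊎ (y ∈ c)
  where import Data.Sum

IsMinVertexCover : (n k : ℕ) .{{_ : NonZero n}} → VSet n → Set
IsMinVertexCover n k c =
  IsVertexCover n k c × (∀ c' → IsVertexCover n k c' → size c ≤ size c')

module Submission where

-- Exchange v_i for its spoke
-- partner u_i:  c = (c* ∖ {v_i}) ∪ {u_i}.  The only edges at v_i are the spoke
-- u_i v_i (now covered by u_i) and the two inner edges, whose other ends are still
-- in c because 0 < k < n makes them different from v_i; every other edge keeps its
-- covering vertex.  Hence c is a cover with |c| ≤ |c*|, so it is minimum, and on the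
-- inner rim it agrees with c* except at v_i.

open import Defs
open import Data.Nat using (ℕ; _+_; _*_; _∸_; _≤_; _<_; _<?_; NonZero)
import Data.Nat as ℕ
open import Data.Nat.Properties
open import Data.Nat.DivMod using (_%_; m<n⇒m%n≡m; m≤n⇒[n∸m]%m≡n%m)
open import Data.Fin using (Fin; toℕ)
import Data.Fin.Properties as Fin
open import Data.Bool using (Bool; true; false; _∨_; _∧_; not)
import Data.Bool as Bool
open import Data.Bool.Properties using (T-≡; T-∨; T-∧)
open import Data.Unit using (tt)
open import Data.Empty using (⊥; ⊥-elim)
open import Data.Product using (Σ; _×_; _,_; proj₁)
open import Data.Sum using (_⊎_; inj₁; inj₂)
import Data.Sum as Sum
open import Data.List using (List; []; _∷_; length; filter; map; allFin)
open import Data.List.Properties using (filter-≐)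
open import Data.List.Relation.Unary.All using (All; []; _∷_)
open import Data.List.Relation.Unary.Any using (here; there)
open import Data.List.Relation.Unary.Unique.Propositional using (Unique; []; _∷_)
import Data.List.Relation.Unary.Unique.Propositional.Properties as Unique
import Data.List.Membership.Propositional as List
open import Data.List.Membership.Propositional.Properties
  using (∈-map⁺; ∈-map⁻; ∈-++⁺ˡ; ∈-++⁺ʳ; ∈-allFin)
open import Function.Bundles using (_⇔_; Equivalence; mk⇔)
open import Relation.Nullary using (¬_; yes; no)
open import Relation.Nullary.Decidable using (does; map′)
open import Relation.Binary.Definitions using (DecidableEquality)
open import Relation.Binary.PropositionalEquality
  using (_≡_; _≢_; refl; sym; trans; cong; subst; module ≡-Reasoning)

mod-wrap : ∀ m n .{{_ : NonZero n}} → m < n + n → m ≡ m % n ⊎ m ≡ m % n + n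
mod-wrap m n m<2n with m <? n
... | yes m<n = inj₁ (sym (m<n⇒m%n≡m m<n))
... | no m≮n = inj₂ (trans (sym (m∸n+n≡m n≤m)) (cong (_+ n) m∸n≡m%n))
  where
  n≤m : n ≤ m
  n≤m = ≮⇒≥ m≮n
  m∸n<n : m ∸ n < n
  m∸n<n = subst (m ∸ n <_) (m+n∸n≡m n n) (∸-monoˡ-< m<2n n≤m)
  m∸n≡m%n : m ∸ n ≡ m % n
  m∸n≡m%n = trans (sym (m<n⇒m%n≡m m∸n<n)) (m≤n⇒[n∸m]%m≡n%m n≤m)

rotate-no-fixpoint : ∀ n k a .{{_ : NonZero n}} → 1 ≤ k → k < n → a < n →
  (a + k) % n ≡ a → ⊥
rotate-no-fixpoint n k a 1≤k k<n a<n fixed with mod-wrap (a + k) n (+-mono-< a<n k<n)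
... | inj₁ e = <⇒≱ 1≤k (≤-reflexive (+-cancelˡ-≡ a k 0 a+k≡a+0))
  where
  a+k≡a+0 : a + k ≡ a + 0
  a+k≡a+0 = trans e (trans fixed (sym (+-identityʳ a)))
... | inj₂ e = <-irrefl (+-cancelˡ-≡ a k n (trans e (cong (_+ n) fixed))) k<n

no-period-gap : ∀ {n} k x y → x < n → x + k ≡ y + k + n → ⊥
no-period-gap {n} k x y x<n gap = <⇒≱ x<n (+-cancelʳ-≤ k n x n+k≤x+k)
  where
  n+k≤x+k : n + k ≤ x + k
  n+k≤x+k = subst (_≤ x + k) (+-comm k n)
              (subst (k + n ≤_) (sym gap) (+-monoˡ-≤ n (m≤n+m k y)))

rotate-injective : ∀ n k a b .{{_ : NonZero n}} → k ≤ n → a < n → b < n →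
  (a + k) % n ≡ (b + k) % n → a ≡ b
rotate-injective n k a b k≤n a<n b<n same
  with mod-wrap (a + k) n (+-mono-<-≤ a<n k≤n) | mod-wrap (b + k) n (+-mono-<-≤ b<n k≤n)
... | inj₁ ea | inj₁ eb = +-cancelʳ-≡ k a b (trans ea (trans same (sym eb)))
... | inj₂ ea | inj₂ eb = +-cancelʳ-≡ k a b (trans ea (trans (cong (_+ n) same) (sym eb)))
... | inj₁ ea | inj₂ eb = ⊥-elim (no-period-gap k b a b<n (trans eb (cong (_+ n) (trans (sym same) (sym ea)))))
... | inj₂ ea | inj₁ eb = ⊥-elim (no-period-gap k a b a<n (trans ea (cong (_+ n) (trans same (sym eb)))))

u-injective : ∀ {n} {a b : Fin n} → u a ≡ u b → a ≡ b
u-injective refl = refl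

v-injective : ∀ {n} {a b : Fin n} → v a ≡ v b → a ≡ b
v-injective refl = refl

_≟ᵥ_ : ∀ {n} → DecidableEquality (Vertex n)
u a ≟ᵥ u b = map′ (cong u) u-injective (a Fin.≟ b)
u a ≟ᵥ v b = no λ ()
v a ≟ᵥ u b = no λ ()
v a ≟ᵥ v b = map′ (cong v) v-injective (a Fin.≟ b)

_∪_ : {A : Set} → (A → Bool) → (A → Bool) → A → Bool
(p ∪ q) x = p x ∨ q x

_∩_ : {A : Set} → (A → Bool) → (A → Bool) → A → Bool
(p ∩ q) x = p x ∧ q x

⁅_⁆ : ∀ {n} → Vertex n → VSet n
⁅ x ⁆ y = does (y ≟ᵥ x)

_∖_ : ∀ {n} → VSet n → Vertex n → VSet n
(c ∖ x) y = c y ∧ not (⁅ x ⁆ y)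

∈-∪ˡ : ∀ {n} (c d : VSet n) {y : Vertex n} → y ∈ c → y ∈ (c ∪ d)
∈-∪ˡ _ _ y∈c = Equivalence.from T-∨ (inj₁ y∈c)

∈-∪ʳ : ∀ {n} (c d : VSet n) {y : Vertex n} → y ∈ d → y ∈ (c ∪ d)
∈-∪ʳ _ _ y∈d = Equivalence.from T-∨ (inj₂ y∈d)

∈-⁅⁆ : ∀ {n} (x : Vertex n) → x ∈ ⁅ x ⁆
∈-⁅⁆ x with x ≟ᵥ x
... | yes _ = tt
... | no x≢x = x≢x refl

∈-∖ : ∀ {n} (c : VSet n) (x : Vertex n) {y : Vertex n} → y ∈ c → y ≢ x → y ∈ (c ∖ x)
∈-∖ _ x {y} y∈c y≢x with y ≟ᵥ x
... | yes y≡x = ⊥-elim (y≢x y≡x)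
... | no _ = Equivalence.from T-∧ (y∈c , tt)

∈-exchange : ∀ {n} (c : VSet n) (x z y : Vertex n) → y ≢ z →
  y ∈ ((c ∖ x) ∪ ⁅ z ⁆) ⇔ (y ∈ c × y ≢ x)
∈-exchange c x z y y≢z with c y | y ≟ᵥ x | y ≟ᵥ z
... | _     | _        | yes y≡z = ⊥-elim (y≢z y≡z)
... | true  | no y≢x   | no _    = mk⇔ (λ _ → tt , y≢x) (λ _ → tt)
... | true  | yes y≡x  | no _    = mk⇔ (λ ()) (λ (_ , y≢x) → ⊥-elim (y≢x y≡x))
... | false | _        | no _    = mk⇔ (λ ()) (λ ())

#[_] : {A : Set} → (A → Bool) → List A → ℕ
#[ p ] xs = length (filter (λ x → p x Bool.≟ true) xs)

#-cong : {A : Set} {p q : A → Bool} → (∀ x → p x ≡ q x) → ∀ xs → #[ p ] xs ≡ #[ q ] xs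
#-cong {p = p} {q} p≗q xs = cong length (filter-≐ _ _ (p⊆q , q⊆p) xs)
  where
  p⊆q : ∀ {x} → p x ≡ true → q x ≡ true
  p⊆q {x} px = trans (sym (p≗q x)) px
  q⊆p : ∀ {x} → q x ≡ true → p x ≡ true
  q⊆p {x} qx = trans (p≗q x) qx

#-∪-∩ : {A : Set} (p q : A → Bool) → ∀ xs → #[ p ∪ q ] xs + #[ p ∩ q ] xs ≡ #[ p ] xs + #[ q ] xs
#-∪-∩ p q [] = refl
#-∪-∩ p q (x ∷ xs) with p x | q x | #-∪-∩ p q xs
... | true  | true  | ih = cong ℕ.suc (trans (+-suc _ _) (trans (cong ℕ.suc ih) (sym (+-suc _ _))))
... | true  | false | ih = cong ℕ.suc ih
... | false | true  | ih = trans (cong ℕ.suc ih) (sym (+-suc _ _))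
... | false | false | ih = ih

#-⁅⁆-absent : ∀ {n} {x : Vertex n} {xs} → All (x ≢_) xs → #[ ⁅ x ⁆ ] xs ≡ 0
#-⁅⁆-absent [] = refl
#-⁅⁆-absent {x = x} {y ∷ ys} (x≢y ∷ x∉ys) with y ≟ᵥ x
... | yes y≡x = ⊥-elim (x≢y (sym y≡x))
... | no _ = #-⁅⁆-absent x∉ys

#-⁅⁆-unique : ∀ {n} {x : Vertex n} {xs} → Unique xs → x List.∈ xs → #[ ⁅ x ⁆ ] xs ≡ 1
#-⁅⁆-unique {x = x} {y ∷ ys} (y∉ys ∷ ys-unique) x∈ with y ≟ᵥ x | x∈
... | yes refl | _ = cong ℕ.suc (#-⁅⁆-absent y∉ys)
... | no y≢x | here x≡y = ⊥-elim (y≢x (sym x≡y))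
... | no _ | there x∈ys = #-⁅⁆-unique ys-unique x∈ys

vertices-unique : ∀ n → Unique (vertices n)
vertices-unique n = Unique.++⁺ (Unique.map⁺ u-injective (Unique.allFin⁺ n))
                                (Unique.map⁺ v-injective (Unique.allFin⁺ n)) u≠v
  where
  u≠v : ∀ {x} → ¬ (x List.∈ map u (allFin n) × x List.∈ map v (allFin n))
  u≠v (x∈us , x∈vs) with ∈-map⁻ u x∈us | ∈-map⁻ v x∈vs
  ... | _ , _ , refl | _ , _ , ()

∈-vertices : ∀ {n} (x : Vertex n) → x List.∈ vertices n
∈-vertices {n} (u a) = ∈-++⁺ˡ (∈-map⁺ u (∈-allFin a))
∈-vertices {n} (v a) = ∈-++⁺ʳ (map u (allFin n)) (∈-map⁺ v (∈-allFin a))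

#-⁅⁆-vertices : ∀ {n} (x : Vertex n) → #[ ⁅ x ⁆ ] (vertices n) ≡ 1
#-⁅⁆-vertices {n} x = #-⁅⁆-unique (vertices-unique n) (∈-vertices x)

#-none : {A : Set} (xs : List A) → #[ (λ _ → false) ] xs ≡ 0
#-none [] = refl
#-none (_ ∷ xs) = #-none xs

∖-∪-⁅⁆ : ∀ {n} (c : VSet n) (x : Vertex n) → x ∈ c → ∀ y → ((c ∖ x) ∪ ⁅ x ⁆) y ≡ c y
∖-∪-⁅⁆ c x x∈c y with c y in cy | y ≟ᵥ x
... | true  | yes _    = refl
... | true  | no _     = refl
... | false | no _     = refl
... | false | yes refl = sym (trans (sym cy) (Equivalence.to T-≡ x∈c))

∖-∩-⁅⁆ : ∀ {n} (c : VSet n) (x : Vertex n) → ∀ y → ((c ∖ x) ∩ ⁅ x ⁆) y ≡ false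
∖-∩-⁅⁆ c x y with c y | y ≟ᵥ x
... | true  | yes _ = refl
... | true  | no _  = refl
... | false | _     = refl

size-∖ : ∀ {n} (c : VSet n) (x : Vertex n) → x ∈ c → size c ≡ size (c ∖ x) + 1
size-∖ {n} c x x∈c = begin
  #[ c ] xs                                      ≡⟨ #-cong (λ y → sym (∖-∪-⁅⁆ c x x∈c y)) xs ⟩
  #[ (c ∖ x) ∪ ⁅ x ⁆ ] xs                         ≡⟨ sym (+-identityʳ _) ⟩
  #[ (c ∖ x) ∪ ⁅ x ⁆ ] xs + 0                     ≡⟨ cong (#[ (c ∖ x) ∪ ⁅ x ⁆ ] xs +_) (sym no-overlap) ⟩
  #[ (c ∖ x) ∪ ⁅ x ⁆ ] xs + #[ (c ∖ x) ∩ ⁅ x ⁆ ] xs ≡⟨ #-∪-∩ (c ∖ x) ⁅ x ⁆ xs ⟩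
  #[ c ∖ x ] xs + #[ ⁅ x ⁆ ] xs                   ≡⟨ cong (#[ c ∖ x ] xs +_) (#-⁅⁆-vertices x) ⟩
  #[ c ∖ x ] xs + 1                              ∎
  where
  open ≡-Reasoning
  xs = vertices n
  no-overlap : #[ (c ∖ x) ∩ ⁅ x ⁆ ] xs ≡ 0
  no-overlap = trans (#-cong (∖-∩-⁅⁆ c x) xs) (#-none xs)

size-∪-⁅⁆ : ∀ {n} (c : VSet n) (x : Vertex n) → size (c ∪ ⁅ x ⁆) ≤ size c + 1
size-∪-⁅⁆ {n} c x = begin
  #[ c ∪ ⁅ x ⁆ ] xs                              ≤⟨ m≤m+n _ _ ⟩
  #[ c ∪ ⁅ x ⁆ ] xs + #[ c ∩ ⁅ x ⁆ ] xs           ≡⟨ #-∪-∩ c ⁅ x ⁆ xs ⟩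
  #[ c ] xs + #[ ⁅ x ⁆ ] xs                       ≡⟨ cong (#[ c ] xs +_) (#-⁅⁆-vertices x) ⟩
  #[ c ] xs + 1                                  ∎
  where
  open ≤-Reasoning
  xs = vertices n

size-exchange : ∀ {n} (c : VSet n) (x y : Vertex n) → x ∈ c → size ((c ∖ x) ∪ ⁅ y ⁆) ≤ size c
size-exchange c x y x∈c = ≤-trans (size-∪-⁅⁆ (c ∖ x) y) (≤-reflexive (sym (size-∖ c x x∈c)))

cover-exchange : ∀ {n k} .{{_ : NonZero n}} {c d : VSet n} (x : Vertex n) →
  IsVertexCover n k c → (∀ y → y ≢ x → y ∈ c → y ∈ d) →
  (∀ y → Edge n k x y → y ∈ d) → (∀ y → Edge n k y x → y ∈ d) →
  IsVertexCover n k d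
cover-exchange x cov keep out inc a b e with a ≟ᵥ x | b ≟ᵥ x
... | yes refl | _        = inj₂ (out b e)
... | no _     | yes refl = inj₁ (inc a e)
... | no a≢x   | no b≢x   = Sum.map (keep a a≢x) (keep b b≢x) (cov a b e)

rotate-moves : ∀ {n k} .{{_ : NonZero n}} {a b : Fin n} → 1 ≤ k → k < n →
  toℕ b ≡ (toℕ a + k) % n → a ≢ b
rotate-moves {n} {k} {a} 1≤k k<n hb refl = rotate-no-fixpoint n k (toℕ a) 1≤k k<n (Fin.toℕ<n a) (sym hb)

edge-from-inner : ∀ {n k} .{{_ : NonZero n}} {a a⁺ : Fin n} → toℕ a⁺ ≡ (toℕ a + k) % n →
  ∀ {y} → Edge n k (v a) y → y ≡ v a⁺
edge-from-inner ha⁺ (inner _ b p) = cong v (Fin.toℕ-injective (trans p (sym ha⁺)))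

edge-into-inner : ∀ {n k} .{{_ : NonZero n}} {a a⁻ : Fin n} → k ≤ n → toℕ a ≡ (toℕ a⁻ + k) % n →
  ∀ {y} → Edge n k y (v a) → y ≡ u a ⊎ y ≡ v a⁻
edge-into-inner k≤n ha⁻ (spoke _) = inj₁ refl
edge-into-inner {n} {k} {a⁻ = a⁻} k≤n ha⁻ (inner b _ p) =
  inj₂ (cong v (Fin.toℕ-injective
    (rotate-injective n k (toℕ b) (toℕ a⁻) k≤n (Fin.toℕ<n b) (Fin.toℕ<n a⁻) (trans (sym p) ha⁻))))

swap-cover : ∀ {n k} .{{_ : NonZero n}} → 1 ≤ k → k < n →
  {c : VSet n} → IsVertexCover n k c → {i i⁻ i⁺ : Fin n} →
  toℕ i ≡ (toℕ i⁻ + k) % n → toℕ i⁺ ≡ (toℕ i + k) % n →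
  v i⁻ ∈ c → v i⁺ ∈ c → IsVertexCover n k ((c ∖ v i) ∪ ⁅ u i ⁆)
swap-cover {n} {k} 1≤k k<n {c} cov {i} {i⁻} {i⁺} hi⁻ hi⁺ vi⁻∈c vi⁺∈c =
  cover-exchange (v i) cov keep out inc
  where
  d : VSet n
  d = (c ∖ v i) ∪ ⁅ u i ⁆
  keep : ∀ y → y ≢ v i → y ∈ c → y ∈ d
  keep y y≢vi y∈c = ∈-∪ˡ (c ∖ v i) ⁅ u i ⁆ (∈-∖ c (v i) y∈c y≢vi)
  out : ∀ y → Edge n k (v i) y → y ∈ d
  out y e with edge-from-inner hi⁺ e
  ... | refl = keep (v i⁺) (λ eq → rotate-moves 1≤k k<n hi⁺ (sym (v-injective eq))) vi⁺∈c
  inc : ∀ y → Edge n k y (v i) → y ∈ d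
  inc y e with edge-into-inner (<⇒≤ k<n) hi⁻ e
  ... | inj₁ refl = ∈-∪ʳ (c ∖ v i) ⁅ u i ⁆ (∈-⁅⁆ (u i))
  ... | inj₂ refl = keep (v i⁻) (λ eq → rotate-moves 1≤k k<n hi⁻ (v-injective eq)) vi⁻∈c

min-cover-by-size : ∀ {n k} .{{_ : NonZero n}} {c d : VSet n} →
  IsMinVertexCover n k c → IsVertexCover n k d → size d ≤ size c → IsMinVertexCover n k d
min-cover-by-size (_ , c-min) d-cover d≤c = d-cover , λ c′ c′-cover → ≤-trans d≤c (c-min c′ c′-cover)

lemma5 : (n k : ℕ) .{{_ : NonZero n}} → 1 ≤ k → 2 * k < n →
    (cstar : VSet n) → IsMinVertexCover n k cstar →
    (i iminus iplus : Fin n) →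
    toℕ i ≡ (toℕ iminus + k) % n → toℕ iplus ≡ (toℕ i + k) % n →
    v i ∈ cstar → v iminus ∈ cstar → v iplus ∈ cstar →
    Σ (VSet n) λ c → IsMinVertexCover n k c ×
    (∀ j → (v j ∈ c) ⇔ ((v j ∈ cstar) × ¬ (j ≡ i)))
lemma5 n k 1≤k 2k<n cstar cstar-min i i⁻ i⁺ hi⁻ hi⁺ vi∈ vi⁻∈ vi⁺∈ =
  c , min-cover-by-size cstar-min c-cover (size-exchange cstar (v i) (u i) vi∈) , c-on-inner
  where
  k<n : k < n                               -- from k ≤ 2k < n
  k<n = ≤-<-trans (m≤m+n k (k + 0)) 2k<n
  c : VSet n
  c = (cstar ∖ v i) ∪ ⁅ u i ⁆
  c-cover : IsVertexCover n k c
  c-cover = swap-cover 1≤k k<n (proj₁ cstar-min) hi⁻ hi⁺ vi⁻∈ vi⁺∈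
  c-on-inner : ∀ j → (v j ∈ c) ⇔ ((v j ∈ cstar) × ¬ (j ≡ i))
  c-on-inner j = mk⇔ (λ vj∈c → let (vj∈ , vj≢vi) = to vj∈c in vj∈ , λ j≡i → vj≢vi (cong v j≡i))
                     (λ (vj∈ , j≢i) → from (vj∈ , λ vj≡vi → j≢i (v-injective vj≡vi)))
    where open Equivalence (∈-exchange cstar (v i) (u i) (v j) λ ())
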